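{- Let $n\ge 2$, let $v$ be an admitted vector and let $[a_1,\ldots,a_n]=F(v)$, where $a_i=i+\sum_{p<i}v_{pi}-\sum_{p>i}v_{ip}$. Then for $1\le i<j\le n$, $$a_j-a_i=j-i+nv_{ij}-\sum_{i<p<j}\delta_{ipj}(v)+\sum_{p<i}\delta_{pij}(v)+\sum_{j<p}\delta_{ijp}(v).$$ Consequently $a_j-a_i=nv_{ij}+r$ with $r\in\{1,\ldots,n-1\}$, and $\lfloor (a_j-a_i)/n\rfloor=v_{ij}$.
   Context: $T=\{(i,j):1\le i<j\le n\}$; $v\in\mathbb N^T$ is admitted if $v_{i,i+1}=0$ and $v_{ij}+v_{jk}\le v_{ik}\le v_{ij}+v_{jk}+1$ for all $i<j<k$. For $i<j<k$, $\delta_{ijk}(v)=v_{ik}-v_{ij}-v_{jk}$; the sums over $p$ range over $1\le p\le n$. -}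

module Defs where

open import Data.Nat as ℕ using (ℕ; zero; suc; _≤_; _<_; _∸_; s≤s; z≤n; NonZero)
open import Data.Integer as ℤ using (ℤ; +_)
open import Data.List using (List; map; upTo; foldr)
open import Data.Product using (_×_)

-- A vector v ∈ ℕ^T, T = {(i,j) : 1 ≤ i < j ≤ n}, is represented as a
-- function ℕ → ℕ → ℕ; only the values v i j with 1 ≤ i < j ≤ n matter.
Vect : Set
Vect = ℕ → ℕ → ℕ

Admitted : ℕ → Vect → Set
Admitted n v =
  (∀ i → 1 ≤ i → suc i ≤ n → v i (suc i) ≡ 0)
  × (∀ i j k → 1 ≤ i → i < j → j < k → k ≤ n →
       (v i j ℕ.+ v j k ≤ v i k) × (v i k ≤ v i j ℕ.+ v j k ℕ.+ 1))
  where open import Relation.Binary.PropositionalEquality using (_≡_)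

δ : Vect → ℕ → ℕ → ℕ → ℤ
δ v i j k = + v i k ℤ.- + v i j ℤ.- + v j k

-- the list lo, lo+1, ..., hi  (empty if hi < lo)
range : ℕ → ℕ → List ℕ
range lo hi = map (lo ℕ.+_) (upTo (suc hi ∸ lo))

Σ[_⋯_] : ℕ → ℕ → (ℕ → ℤ) → ℤ
Σ[ lo ⋯ hi ] f = foldr ℤ._+_ (+ 0) (map f (range lo hi))

F : ℕ → Vect → ℕ → ℤ
F n v i = + i ℤ.+ Σ[ 1 ⋯ i ∸ 1 ] (λ p → + v p i) ℤ.- Σ[ suc i ⋯ n ] (λ p → + v i p)

≥2⇒NonZero : ∀ {n} → 2 ≤ n → NonZero n
≥2⇒NonZero (s≤s _) = _

-- Splitting Σ_{p<j} v_pj at p = i and Σ_{p>i} v_ip at p = j, the difference a_j − a_i regroups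
-- term by term into the δ's: the two split-off copies of v_ij together with the n − 2 copies
-- hidden in the δ-sums give n·v_ij. Admissibility makes every δ equal to 0 or 1, so the
-- remainder (j − i) − Σ_{i<p<j} δ + Σ_{p<i} δ + Σ_{p>j} δ lies between 1 (there are only
-- j − i − 1 middle terms) and n − 1, which also determines the quotient by n.
module Submission where

open import Defs
open import Data.Nat as ℕ using (ℕ; suc; _≤_; _<_; _∸_)
open import Data.Integer as ℤ using (ℤ; +_; _+_; _-_; _*_; _/ℕ_)
open import Data.Product using (_×_; ∃)
open import Relation.Binary.PropositionalEquality using (_≡_)

open import Data.Nat using (zero; z≤n; s≤s; NonZero)
import Data.Nat.Properties as ℕₚ
open import Data.Nat.DivMod using (_/_; +-distrib-/-∣ˡ; m*n/n≡m; m<n⇒m/n≡0)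
open import Data.Nat.Divisibility using (m∣m*n)
import Data.Integer.Properties as ℤₚ
open import Data.Integer.Tactic.RingSolver using (solve-∀)
open import Data.List using (List; []; _∷_; _++_; map; foldr; length; upTo; applyUpTo)
open import Data.List.Properties using (length-map; length-upTo; map-upTo)
open import Data.List.Relation.Unary.All using (All; []; _∷_)
open import Data.List.Relation.Unary.All.Properties using (applyUpTo⁺₁)
open import Data.Product using (_,_)
open import Function using (_∘_)
open import Relation.Binary.PropositionalEquality
  using (refl; sym; trans; cong; cong₂; subst; module ≡-Reasoning)

open ≡-Reasoning

-- Σ[ lo ⋯ hi ] f unfolds to sumOf f (range lo hi).
sumOf : (ℕ → ℤ) → List ℕ → ℤ
sumOf f xs = foldr _+_ (+ 0) (map f xs)

sumOf-++ : ∀ f xs ys → sumOf f (xs ++ ys) ≡ sumOf f xs + sumOf f ys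
sumOf-++ f []       ys = sym (ℤₚ.+-identityˡ _)
sumOf-++ f (x ∷ xs) ys = trans (cong (λ t → f x + t) (sumOf-++ f xs ys)) (sym (ℤₚ.+-assoc (f x) _ _))

sumOf-linear : ∀ f g h xs →
  sumOf (λ p → f p - g p - h p) xs ≡ sumOf f xs - sumOf g xs - sumOf h xs
sumOf-linear f g h []       = refl
sumOf-linear f g h (x ∷ xs) =
  trans (cong (λ t → f x - g x - h x + t) (sumOf-linear f g h xs))
        (interchange (f x) (g x) (h x) (sumOf f xs) (sumOf g xs) (sumOf h xs))
  where
  interchange : ∀ a b c a′ b′ c′ → (a - b - c) + (a′ - b′ - c′) ≡ (a + a′) - (b + b′) - (c + c′)
  interchange = solve-∀

sumOf-const : ∀ c xs → sumOf (λ _ → c) xs ≡ + length xs * c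
sumOf-const c []       = refl
sumOf-const c (x ∷ xs) = trans (cong (λ t → c + t) (sumOf-const c xs)) (sym (ℤₚ.suc-* (+ length xs) c))

IsBit : ℤ → Set
IsBit z = ∃ λ d → d ≤ 1 × z ≡ + d

sumOf-bits : ∀ f xs → All (IsBit ∘ f) xs → ∃ λ s → s ≤ length xs × sumOf f xs ≡ + s
sumOf-bits f []       []                      = 0 , z≤n , refl
sumOf-bits f (x ∷ xs) ((d , d≤1 , fx≡d) ∷ bits) with sumOf-bits f xs bits
... | s , s≤len , sum≡s = d ℕ.+ s , ℕₚ.+-mono-≤ d≤1 s≤len , cong₂ _+_ fx≡d sum≡s

applyUpTo-cong : ∀ {A : Set} {f g : ℕ → A} → (∀ x → f x ≡ g x) → ∀ k → applyUpTo f k ≡ applyUpTo g k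
applyUpTo-cong f≗g zero    = refl
applyUpTo-cong f≗g (suc k) = cong₂ _∷_ (f≗g 0) (applyUpTo-cong (f≗g ∘ suc) k)

applyUpTo-++ : ∀ {A : Set} (f : ℕ → A) k l →
  applyUpTo f (k ℕ.+ l) ≡ applyUpTo f k ++ applyUpTo (f ∘ (k ℕ.+_)) l
applyUpTo-++ f zero    l = refl
applyUpTo-++ f (suc k) l = cong (f 0 ∷_) (applyUpTo-++ (f ∘ suc) k l)

range≡applyUpTo : ∀ lo hi → range lo hi ≡ applyUpTo (lo ℕ.+_) (suc hi ∸ lo)
range≡applyUpTo lo hi = map-upTo (lo ℕ.+_) (suc hi ∸ lo)

length-range : ∀ lo hi → length (range lo hi) ≡ suc hi ∸ lo
length-range lo hi = trans (length-map (lo ℕ.+_) (upTo (suc hi ∸ lo))) (length-upTo (suc hi ∸ lo))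

m<1+n∸o⇒o+m≤n : ∀ {m n o} → m < suc n ∸ o → o ℕ.+ m ≤ n
m<1+n∸o⇒o+m≤n {o = zero}        (s≤s m≤n) = m≤n
m<1+n∸o⇒o+m≤n {n = zero} {suc zero}    ()
m<1+n∸o⇒o+m≤n {n = zero} {suc (suc _)} ()
m<1+n∸o⇒o+m≤n {n = suc n} {suc o} m<   = s≤s (m<1+n∸o⇒o+m≤n {o = o} m<)

All-range : ∀ {P : ℕ → Set} lo hi → (∀ p → lo ≤ p → p ≤ hi → P p) → All P (range lo hi)
All-range {P} lo hi P-in =
  subst (All P) (sym (range≡applyUpTo lo hi))
    (applyUpTo⁺₁ (lo ℕ.+_) (suc hi ∸ lo)
      (λ {m} m< → P-in (lo ℕ.+ m) (ℕₚ.m≤m+n lo m) (m<1+n∸o⇒o+m≤n m<)))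

range-++ : ∀ {lo m hi} → lo ≤ suc m → m ≤ hi → range lo hi ≡ range lo m ++ range (suc m) hi
range-++ {lo} {m} {hi} lo≤1+m m≤hi = begin
  range lo hi                                                 ≡⟨ range≡applyUpTo lo hi ⟩
  applyUpTo (lo ℕ.+_) (suc hi ∸ lo)                           ≡⟨ cong (applyUpTo (lo ℕ.+_)) length-split ⟩
  applyUpTo (lo ℕ.+_) (k ℕ.+ l)                               ≡⟨ applyUpTo-++ (lo ℕ.+_) k l ⟩
  applyUpTo (lo ℕ.+_) k ++ applyUpTo (λ x → lo ℕ.+ (k ℕ.+ x)) l
    ≡⟨ cong₂ _++_ (sym (range≡applyUpTo lo m))
                  (trans (applyUpTo-cong shift l) (sym (range≡applyUpTo (suc m) hi))) ⟩
  range lo m ++ range (suc m) hi                              ∎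
  where
  k = suc m ∸ lo
  l = suc hi ∸ suc m
  length-split : suc hi ∸ lo ≡ k ℕ.+ l
  length-split = begin
    suc hi ∸ lo             ≡⟨ cong (_∸ lo) (ℕₚ.m∸n+n≡m (s≤s m≤hi)) ⟨
    (l ℕ.+ suc m) ∸ lo      ≡⟨ ℕₚ.+-∸-assoc l lo≤1+m ⟩
    l ℕ.+ k                 ≡⟨ ℕₚ.+-comm l k ⟩
    k ℕ.+ l                 ∎
  shift : ∀ x → lo ℕ.+ (k ℕ.+ x) ≡ suc m ℕ.+ x
  shift x = trans (sym (ℕₚ.+-assoc lo k x)) (cong (ℕ._+ x) (ℕₚ.m+[n∸m]≡n lo≤1+m))

range-∷ : ∀ {lo hi} → lo ≤ hi → range lo hi ≡ lo ∷ range (suc lo) hi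
range-∷ {lo} {hi} lo≤hi = begin
  range lo hi                              ≡⟨ range≡applyUpTo lo hi ⟩
  applyUpTo (lo ℕ.+_) (suc hi ∸ lo)        ≡⟨ cong (applyUpTo (lo ℕ.+_)) (ℕₚ.+-∸-assoc 1 lo≤hi) ⟩
  applyUpTo (lo ℕ.+_) (suc (hi ∸ lo))
    ≡⟨ cong₂ _∷_ (ℕₚ.+-identityʳ lo)
                 (trans (applyUpTo-cong (ℕₚ.+-suc lo) (hi ∸ lo)) (sym (range≡applyUpTo (suc lo) hi))) ⟩
  lo ∷ range (suc lo) hi                   ∎

Σ-split : ∀ {lo m hi} (f : ℕ → ℤ) → lo ≤ suc m → suc m ≤ hi →
  Σ[ lo ⋯ hi ] f ≡ Σ[ lo ⋯ m ] f + (f (suc m) + Σ[ suc (suc m) ⋯ hi ] f)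
Σ-split {lo} {m} {hi} f lo≤1+m 1+m≤hi = begin
  sumOf f (range lo hi)
    ≡⟨ cong (sumOf f) (trans (range-++ lo≤1+m (ℕₚ.<⇒≤ 1+m≤hi)) (cong (range lo m ++_) (range-∷ 1+m≤hi))) ⟩
  sumOf f (range lo m ++ suc m ∷ range (suc (suc m)) hi)
    ≡⟨ sumOf-++ f (range lo m) _ ⟩
  Σ[ lo ⋯ m ] f + (f (suc m) + Σ[ suc (suc m) ⋯ hi ] f) ∎

Σ-const : ∀ lo hi c → Σ[ lo ⋯ hi ] (λ _ → c) ≡ + (suc hi ∸ lo) * c
Σ-const lo hi c = trans (sumOf-const c (range lo hi)) (cong (λ k → + k * c) (length-range lo hi))

Σ-bits : ∀ lo hi f → (∀ p → lo ≤ p → p ≤ hi → IsBit (f p)) →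
  ∃ λ s → s ≤ suc hi ∸ lo × Σ[ lo ⋯ hi ] f ≡ + s
Σ-bits lo hi f bit with sumOf-bits f (range lo hi) (All-range lo hi bit)
... | s , s≤len , sum≡s = s , subst (s ≤_) (length-range lo hi) s≤len , sum≡s

gap-lengths : ∀ {a b n} → suc a ≤ b → suc b ≤ n → suc (suc (a ℕ.+ (b ∸ suc a))) ℕ.+ (n ∸ suc b) ≡ n
gap-lengths {a} {b} {n} a<b b<n =
  trans (cong (λ x → suc x ℕ.+ (n ∸ suc b)) (ℕₚ.m+[n∸m]≡n a<b)) (ℕₚ.m+[n∸m]≡n b<n)

F-difference : ∀ n v i j → 1 ≤ i → i < j → j ≤ n →
  F n v j - F n v i
    ≡ + j - + i + + n * + v i j
      - Σ[ suc i ⋯ j ∸ 1 ] (λ p → δ v i p j)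
      + Σ[ 1 ⋯ i ∸ 1 ] (λ p → δ v p i j)
      + Σ[ suc j ⋯ n ] (λ p → δ v i j p)
F-difference n v i@(suc a) j@(suc b) _ (s≤s a<b) j≤n = begin
  F n v j - F n v i
    ≡⟨ cong₂ (λ x y → (+ j + x - Uj) - (+ i + Li - y))
             (Σ-split (λ p → + v p j) (s≤s z≤n) a<b) (Σ-split (λ p → + v i p) (s≤s a<b) j≤n) ⟩
  (+ j + (Lj + (w + Mj)) - Uj) - (+ i + Li - (Mi + (w + Ui)))
    ≡⟨ rearrange (+ j) (+ i) (+ a) (+ cm) (+ cu) w Lj Li Mj Mi Uj Ui ⟩
  + j - + i + + (suc (suc (a ℕ.+ cm)) ℕ.+ cu) * w
    - (+ cm * w - Mi - Mj) + (Lj - Li - + a * w) + (Ui - + cu * w - Uj)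
    ≡⟨ cong₂ _+_ (cong₂ _+_ (cong₂ (λ N x → + j - + i + + N * w - x) (gap-lengths a<b j≤n) (sym Σ-middle))
                            (sym Σ-below))
                 (sym Σ-above) ⟩
  + j - + i + + n * w
    - Σ[ suc i ⋯ b ] (λ p → δ v i p j)
    + Σ[ 1 ⋯ a ] (λ p → δ v p i j)
    + Σ[ suc j ⋯ n ] (λ p → δ v i j p) ∎
  where
  w = + v i j
  cm = b ∸ suc a
  cu = n ∸ suc b
  Lj = Σ[ 1 ⋯ a ] (λ p → + v p j)
  Li = Σ[ 1 ⋯ a ] (λ p → + v p i)
  Mj = Σ[ suc i ⋯ b ] (λ p → + v p j)
  Mi = Σ[ suc i ⋯ b ] (λ p → + v i p)
  Uj = Σ[ suc j ⋯ n ] (λ p → + v j p)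
  Ui = Σ[ suc j ⋯ n ] (λ p → + v i p)
  rearrange : ∀ J I A M U W LJ LI MJ MI UJ UI →
    (J + (LJ + (W + MJ)) - UJ) - (I + LI - (MI + (W + UI)))
      ≡ J - I + (+ 1 + (+ 1 + A + M) + U) * W - (M * W - MI - MJ) + (LJ - LI - A * W) + (UI - U * W - UJ)
  rearrange = solve-∀
  Σ-middle : Σ[ suc i ⋯ b ] (λ p → δ v i p j) ≡ + cm * w - Mi - Mj
  Σ-middle = trans (sumOf-linear (λ _ → w) (λ p → + v i p) (λ p → + v p j) (range (suc i) b))
                   (cong (λ c → c - Mi - Mj) (Σ-const (suc i) b w))
  Σ-below : Σ[ 1 ⋯ a ] (λ p → δ v p i j) ≡ Lj - Li - + a * w
  Σ-below = trans (sumOf-linear (λ p → + v p j) (λ p → + v p i) (λ _ → w) (range 1 a))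
                  (cong (λ c → Lj - Li - c) (Σ-const 1 a w))
  Σ-above : Σ[ suc j ⋯ n ] (λ p → δ v i j p) ≡ Ui - + cu * w - Uj
  Σ-above = trans (sumOf-linear (λ p → + v i p) (λ _ → w) (λ p → + v j p) (range (suc j) n))
                  (cong (λ c → Ui - c - Uj) (Σ-const (suc j) n w))

bit-gap : ∀ {x y z} → x ℕ.+ y ≤ z → z ≤ x ℕ.+ y ℕ.+ 1 → IsBit (+ z - + x - + y)
bit-gap {x} {y} {z} x+y≤z z≤x+y+1 = d , d≤1 , gap≡d
  where
  d = z ∸ (x ℕ.+ y)
  z≡x+y+d : x ℕ.+ y ℕ.+ d ≡ z
  z≡x+y+d = ℕₚ.m+[n∸m]≡n x+y≤z
  d≤1 : d ≤ 1
  d≤1 = ℕₚ.+-cancelˡ-≤ (x ℕ.+ y) d 1 (ℕₚ.≤-trans (ℕₚ.≤-reflexive z≡x+y+d) z≤x+y+1)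
  cancel : ∀ x y d → x + y + d - x - y ≡ d
  cancel = solve-∀
  gap≡d : + z - + x - + y ≡ + d
  gap≡d = trans (cong (λ t → + t - + x - + y) (sym z≡x+y+d)) (cancel (+ x) (+ y) (+ d))

δ-isBit : ∀ {n v} → Admitted n v → ∀ {p q r} → 1 ≤ p → p < q → q < r → r ≤ n → IsBit (δ v p q r)
δ-isBit {v = v} (_ , triangle) {p} {q} {r} 1≤p p<q q<r r≤n with triangle p q r 1≤p p<q q<r r≤n
... | lower , upper = bit-gap {v p q} {v q r} {v p r} lower upper

F-difference-decomposition : ∀ n v → Admitted n v → ∀ i j → 1 ≤ i → i < j → j ≤ n →
  ∃ λ r → 1 ≤ r × r ≤ n ∸ 1 × F n v j - F n v i ≡ + (n ℕ.* v i j) + + r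
F-difference-decomposition n v adm i@(suc a) j@(suc b) 1≤i i<j@(s≤s a<b) j≤n
  with Σ-bits (suc i) b (λ p → δ v i p j) (λ p i<p p≤b → δ-isBit adm 1≤i i<p (s≤s p≤b) j≤n)
     | Σ-bits 1 a (λ p → δ v p i j) (λ p 1≤p p≤a → δ-isBit adm 1≤p (s≤s p≤a) i<j j≤n)
     | Σ-bits (suc j) n (λ p → δ v i j p) (λ p j<p p≤n → δ-isBit adm 1≤i i<j j<p p≤n)
... | sm , sm≤cm , Σ-middle | sl , sl≤a , Σ-below | su , su≤cu , Σ-above =
  r , 1≤r , r≤n-1 , difference
  where
  cm = b ∸ suc a
  cu = n ∸ suc b
  w = v i j
  t = suc cm ∸ sm
  r = sl ℕ.+ t ℕ.+ su
  1≤r : 1 ≤ r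
  1≤r = ℕₚ.≤-trans (ℕₚ.m<n⇒0<n∸m (s≤s sm≤cm)) (ℕₚ.≤-trans (ℕₚ.m≤n+m t sl) (ℕₚ.m≤m+n _ su))
  r≤n-1 : r ≤ n ∸ 1
  r≤n-1 = ℕₚ.≤-trans (ℕₚ.+-mono-≤ (ℕₚ.+-mono-≤ sl≤a (ℕₚ.m∸n≤m (suc cm) sm)) su≤cu)
            (ℕₚ.≤-reflexive (trans (cong (ℕ._+ cu) (ℕₚ.+-suc a cm)) (cong (_∸ 1) (gap-lengths a<b j≤n))))
  j≡i+sm+t : j ≡ i ℕ.+ (sm ℕ.+ t)
  j≡i+sm+t = cong suc (begin
    b                      ≡⟨ ℕₚ.m+[n∸m]≡n a<b ⟨
    suc (a ℕ.+ cm)         ≡⟨ ℕₚ.+-suc a cm ⟨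
    a ℕ.+ suc cm           ≡⟨ cong (a ℕ.+_) (ℕₚ.m+[n∸m]≡n (ℕₚ.m≤n⇒m≤1+n sm≤cm)) ⟨
    a ℕ.+ (sm ℕ.+ t)       ∎)
  collect : ∀ I S T L U N W → I + (S + T) - I + N * W - S + L + U ≡ N * W + (L + T + U)
  collect = solve-∀
  difference : F n v j - F n v i ≡ + (n ℕ.* w) + + r
  difference = begin
    F n v j - F n v i
      ≡⟨ F-difference n v i j 1≤i i<j j≤n ⟩
    + j - + i + + n * + w
      - Σ[ suc i ⋯ b ] (λ p → δ v i p j) + Σ[ 1 ⋯ a ] (λ p → δ v p i j) + Σ[ suc j ⋯ n ] (λ p → δ v i j p)
      ≡⟨ cong₂ _+_ (cong₂ _+_ (cong₂ (λ J x → + J - + i + + n * + w - x) j≡i+sm+t Σ-middle) Σ-below) Σ-above ⟩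
    + (i ℕ.+ (sm ℕ.+ t)) - + i + + n * + w - + sm + + sl + + su
      ≡⟨ collect (+ i) (+ sm) (+ t) (+ sl) (+ su) (+ n) (+ w) ⟩
    + n * + w + + r
      ≡⟨ cong (_+ + r) (ℤₚ.pos-* n w) ⟨
    + (n ℕ.* w) + + r  ∎

[n*q+r]/n≡q : ∀ {n} q {r} .{{_ : NonZero n}} → r < n → (+ (n ℕ.* q) + + r) /ℕ n ≡ + q
[n*q+r]/n≡q {n} q {r} r<n = cong +_ (begin
  (n ℕ.* q ℕ.+ r) / n        ≡⟨ +-distrib-/-∣ˡ r (m∣m*n q) ⟩
  n ℕ.* q / n ℕ.+ r / n      ≡⟨ cong₂ ℕ._+_ (trans (cong (_/ n) (ℕₚ.*-comm n q)) (m*n/n≡m q n)) (m<n⇒m/n≡0 r<n) ⟩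
  q ℕ.+ 0                    ≡⟨ ℕₚ.+-identityʳ q ⟩
  q                          ∎)

lemma6p4 : (n : ℕ) (n≥2 : 2 ≤ n) (v : Vect) → Admitted n v →
    ∀ i j → 1 ≤ i → i < j → j ≤ n →
      (F n v j - F n v i
         ≡ + j - + i + + n * + v i j
           - Σ[ suc i ⋯ j ∸ 1 ] (λ p → δ v i p j)
           + Σ[ 1 ⋯ i ∸ 1 ] (λ p → δ v p i j)
           + Σ[ suc j ⋯ n ] (λ p → δ v i j p))
      × (∃ λ r → 1 ≤ r × r ≤ n ∸ 1 × F n v j - F n v i ≡ + (n ℕ.* v i j) + + r)
      × (_/ℕ_ (F n v j - F n v i) n {{≥2⇒NonZero n≥2}} ≡ + v i j)
lemma6p4 n n≥2@(s≤s (s≤s _)) v adm i j 1≤i i<j j≤n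
  with F-difference-decomposition n v adm i j 1≤i i<j j≤n
... | decomposition@(r , _ , r≤n-1 , difference) =
  F-difference n v i j 1≤i i<j j≤n ,
  decomposition ,
  trans (cong (λ x → _/ℕ_ x n {{≥2⇒NonZero n≥2}}) difference) ([n*q+r]/n≡q (v i j) (s≤s r≤n-1))
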